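{- If $T$ is a tree of order $n\ge 2$, then $\zeta_1(T)\le \lceil \log_2 n\rceil$.
   Context: All graphs are finite, connected, and without multiple edges. For a vertex $x$, $N(x)$ is its set of neighbours ($x\notin N(x)$) and $N[x]=N(x)\cup\{x\}$. The one-visibility Localization game with $k$ cops on a graph $G$: the robber first chooses a starting vertex; then in each round the cops choose (probe) vertices $u_1,\dots,u_k$ of $G$ (any vertices), and for each $i$ the probe returns $0$ if the robber is on $u_i$, $1$ if the robber is adjacent to $u_i$, and $\ast$ otherwise; then the robber moves to a vertex of $N[v]$, where $v$ is its current vertex. The cops win if after finitely many rounds the information obtained determines the robber's current vertex uniquely; the robber is omniscient. $\zeta_1(G)$ is the least positive integer $k$ such that $k$ cops have a winning strategy. -}

module Defs where

open import Data.Nat using (ℕ; zero; suc; _≤_)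
open import Data.Nat.Logarithm using (⌈log₂_⌉) public
open import Data.Fin using (Fin)
open import Data.Fin.Properties using () renaming (_≟_ to _≟F_)
open import Data.Bool using (Bool; true; false)
open import Data.List using (List; []; _∷_; length; last)
open import Data.List.Relation.Unary.Unique.Propositional using (Unique)
open import Data.List.Relation.Unary.Linked using (Linked)
open import Data.Vec using (Vec; map)
open import Data.Maybe using (Maybe; just; nothing)
open import Data.Product using (Σ; ∃; _×_; _,_)
open import Data.Sum using (_⊎_)
open import Relation.Nullary using (¬_; yes; no)
open import Relation.Binary.PropositionalEquality using (_≡_)

record Graph (n : ℕ) : Set where
  field
    adj   : Fin n → Fin n → Bool
    sym   : ∀ u v → adj u v ≡ adj v u
    irrefl : ∀ u → adj u u ≡ false
open Graph public

data Walk {n : ℕ} (G : Graph n) : Fin n → Fin n → Set where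
  here : ∀ {u} → Walk G u u
  step : ∀ {u w v} → adj G u w ≡ true → Walk G w v → Walk G u v

Connected : ∀ {n} → Graph n → Set
Connected G = ∀ u v → Walk G u v

IsCycle : ∀ {n} → Graph n → List (Fin n) → Set
IsCycle G [] = Data.Empty.⊥
  where import Data.Empty
IsCycle G (x ∷ xs) =
  (3 ≤ length (x ∷ xs)) × Unique (x ∷ xs)
  × Linked (λ a b → adj G a b ≡ true) (x ∷ xs)
  × (∀ y → last (x ∷ xs) ≡ just y → adj G y x ≡ true)

Acyclic : ∀ {n} → Graph n → Set
Acyclic G = ∀ c → ¬ IsCycle G c

IsTree : ∀ {n} → Graph n → Set
IsTree G = Connected G × Acyclic G

data Resp : Set where
  r0 r1 r* : Resp

probe : ∀ {n} → Graph n → Fin n → Fin n → Resp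
probe G u v with u ≟F v
... | yes _ = r0
... | no _ with adj G u v
...   | true = r1
...   | false = r*

-- Robber trajectories: position at round t (before the probes of round t),
-- each move to a vertex of the closed neighbourhood.
Trajectory : ∀ {n} → Graph n → Set
Trajectory {n} G = Σ (ℕ → Fin n) λ r → ∀ t → r (suc t) ≡ r t ⊎ adj G (r t) (r (suc t)) ≡ true

-- A strategy for k cops: probes chosen from the history of all previous answers
-- (the cops' own earlier probes are determined by the strategy itself).
Strategy : ∀ {n} → Graph n → ℕ → Set
Strategy {n} G k = List (Vec Resp k) → Vec (Fin n) k

-- History of answers of rounds 0..t-1 (most recent first).
history : ∀ {n k} (G : Graph n) → Strategy G k → (ℕ → Fin n) → ℕ → List (Vec Resp k)
history G σ r zero = []
history G σ r (suc t) =
  let h = history G σ r t in map (λ u → probe G u (r t)) (σ h) ∷ h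

LocatedAt : ∀ {n k} (G : Graph n) → Strategy G k → Trajectory G → ℕ → Set
LocatedAt G σ (r , _) t =
  ∀ (τ : Trajectory G) → history G σ (Data.Product.proj₁ τ) (suc t) ≡ history G σ r (suc t)
    → Data.Product.proj₁ τ t ≡ r t

Winning : ∀ {n k} (G : Graph n) → Strategy G k → Set
Winning G σ = ∀ (τ : Trajectory G) → ∃ λ t → LocatedAt G σ τ t

CopsWin : ∀ {n} → Graph n → ℕ → Set
CopsWin G k = Σ (Strategy G k) (Winning G)

ζ₁≤ : ∀ {n} → Graph n → ℕ → Set
ζ₁≤ G m = ∃ λ k → (1 ≤ k) × (k ≤ m) × CopsWin G k

-- Root the tree and let one cop probe a centroid c in every round: a robber that
-- ever steps on c is located at once, otherwise it stays inside one component of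
-- T − c, each of which has at most n/2 vertices. A robber in one component answers
-- ∗ to every probe inside another, so the components can be handled one after the
-- other by the same remaining cops, provided that in each of them the robber is
-- heard (some answer other than ∗) before it is located. If n ≤ 2^k, all but at
-- most one component have fewer than 2^(k-1) vertices and are handled in this way
-- recursively; the exceptional one, with at most 2^(k-1) vertices, comes last and
-- is treated like T with k − 1 cops.

module Submission where

open import Defs using (Graph; adj; Walk; here; step; Connected; Acyclic; IsTree; Resp; r0; r*; probe;
                       Strategy; history; Winning; CopsWin; ζ₁≤; ⌈log₂_⌉)
open import Data.Bool using (Bool; true; false; _∧_; _∨_; not; if_then_else_)
open import Data.Bool.Properties using (∨-zeroʳ; ¬-not) renaming (_≟_ to _≟ᵇ_)
open import Data.Empty using (⊥-elim)
open import Data.Fin using (Fin; zero; suc)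
open import Data.Fin.Properties using (any?) renaming (_≟_ to _≟ᶠ_)
open import Data.List using (List; []; _∷_; length; last; allFin)
open import Data.List.Extrema.Nat using (argmax; f[⊥]≤f[argmax]; f[xs]≤f[argmax])
open import Data.List.Membership.DecPropositional using () renaming (_∈_ to _∈ₗ_; _∈?_ to _∈ₗ?_)
open import Data.List.Membership.Propositional.Properties using (∈-allFin)
open import Data.List.Properties using (∷-injectiveˡ; ∷-injectiveʳ)
import Data.List.Relation.Unary.All as All
open import Data.List.Relation.Unary.All.Properties using (¬Any⇒All¬)
open import Data.List.Relation.Unary.AllPairs using ([]; _∷_)
open import Data.List.Relation.Unary.Any using (here; there)
open import Data.List.Relation.Unary.Linked using (Linked; [-]; _∷_)
open import Data.List.Relation.Unary.Unique.Propositional using (Unique)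
open import Data.Maybe using (Maybe; just; nothing; fromMaybe)
open import Data.Maybe.Properties using (just-injective)
open import Data.Nat using (ℕ; zero; suc; _+_; _*_; _∸_; _^_; _≤_; _<_; z≤n; s≤s; _≤?_; _<?_; ⌈_/2⌉)
open import Data.Nat.Induction using (<-wellFounded)
open import Data.Nat.Logarithm.Core using (⌈log2⌉)
open import Data.Nat.Properties
open import Data.Product using (Σ; Σ-syntax; _×_; _,_; proj₁; proj₂)
open import Data.Sum using (_⊎_; inj₁; inj₂; swap)
open import Data.Vec as Vec using (Vec; tabulate; lookup)
open import Data.Vec.Properties using (lookup-map; lookup∘tabulate)
open import Function using (_∘_; id)
open import Induction.WellFounded using (Acc; acc)
open import Relation.Binary.Construct.Closure.ReflexiveTransitive using (Star; ε; _◅_; _◅◅_; reverse)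
open import Relation.Binary.Definitions using (DecidableEquality)
open import Relation.Binary.PropositionalEquality
open import Relation.Nullary using (Dec; does; ¬_; yes; no; contradiction; ¬?; _×-dec_)
open import Relation.Nullary.Decidable using (dec-true; dec-false)

module _ where

  VertexSet : ℕ → Set
  VertexSet n = Fin n → Bool

  private variable
    n : ℕ
    S P U : VertexSet n
    u v : Fin n

  infix 4 _∈_ _∉_ _⊆_ _∈?_
  infixl 7 _∩_
  infixl 6 _∖_

  -- A record rather than the bare equation S v ≡ true, so that S and v can be
  -- inferred from membership proofs.
  record _∈_ (v : Fin n) (S : VertexSet n) : Set where
    constructor holds
    field is-true : S v ≡ true
  open _∈_ public

  _∉_ : Fin n → VertexSet n → Set
  v ∉ S = ¬ v ∈ S

  _∈?_ : (v : Fin n) (S : VertexSet n) → Dec (v ∈ S)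
  v ∈? S with S v in eq
  ... | true  = yes (holds eq)
  ... | false = no λ where (holds v∈S) → contradiction (trans (sym eq) v∈S) λ ()

  ∉⇒≡false : v ∉ S → S v ≡ false
  ∉⇒≡false v∉S = ¬-not (v∉S ∘ holds)

  _⊆_ : VertexSet n → VertexSet n → Set
  S ⊆ P = ∀ {v} → v ∈ S → v ∈ P

  _∩_ _∖_ : VertexSet n → VertexSet n → VertexSet n
  (S ∩ P) v = S v ∧ P v
  (S ∖ P) v = S v ∧ not (P v)

  ⟦_⟧ : {P : Fin n → Set} → (∀ v → Dec (P v)) → VertexSet n
  ⟦ P? ⟧ v = does (P? v)

  ⁅_⁆ : Fin n → VertexSet n
  ⁅ c ⁆ = ⟦ _≟ᶠ c ⟧

  ∈-∩ : v ∈ S → v ∈ P → v ∈ S ∩ P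
  ∈-∩ {v = v} {P = P} (holds v∈S) (holds v∈P) = holds (trans (cong (_∧ P v) v∈S) v∈P)

  ∈-∩⁻ : v ∈ S ∩ P → v ∈ S × v ∈ P
  ∈-∩⁻ {v = v} {S = S} (holds v∈) with S v in eq
  ... | true = holds eq , holds v∈

  ∈-∖ : v ∈ S → v ∉ P → v ∈ S ∖ P
  ∈-∖ {v = v} {P = P} (holds v∈S) v∉P with P v in eq
  ... | false = holds (cong₂ (λ a b → a ∧ not b) v∈S eq)
  ... | true  = contradiction (holds eq) v∉P

  ∈-∖⁻ : v ∈ S ∖ P → v ∈ S × v ∉ P
  ∈-∖⁻ {v = v} {S = S} {P = P} (holds v∈) with S v in eq | P v in eq′
  ... | true | false = holds eq , λ (holds e) → contradiction (trans (sym eq′) e) λ ()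

  ∈⟦⟧ : {P : Fin n → Set} {P? : ∀ v → Dec (P v)} → P v → v ∈ ⟦ P? ⟧
  ∈⟦⟧ {v = v} {P? = P?} p = holds (dec-true (P? v) p)

  ∈⟦⟧⁻ : {P : Fin n → Set} {P? : ∀ v → Dec (P v)} → v ∈ ⟦ P? ⟧ → P v
  ∈⟦⟧⁻ {v = v} {P? = P?} (holds v∈) with P? v
  ... | yes p = p

  ∈⁅⁆ : v ∈ ⁅ v ⁆
  ∈⁅⁆ {v = v} = ∈⟦⟧ {P? = _≟ᶠ v} refl

  ∈⁅⁆⁻ : u ∈ ⁅ v ⁆ → u ≡ v
  ∈⁅⁆⁻ {v = v} = ∈⟦⟧⁻ {P? = _≟ᶠ v}

  ∉⁅⁆⇒≢ : u ∉ ⁅ v ⁆ → u ≢ v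
  ∉⁅⁆⇒≢ u∉ refl = u∉ ∈⁅⁆

  private
    ∣_∣ᵇ : Bool → ℕ
    ∣ true  ∣ᵇ = 1
    ∣ false ∣ᵇ = 0

    ∣∣ᵇ-mono : ∀ {b b′} → (b ≡ true → b′ ≡ true) → ∣ b ∣ᵇ ≤ ∣ b′ ∣ᵇ
    ∣∣ᵇ-mono {false} _ = z≤n
    ∣∣ᵇ-mono {true} b⇒b′ rewrite b⇒b′ refl = ≤-refl

  ∣_∣ : VertexSet n → ℕ
  ∣_∣ {zero}  S = 0
  ∣_∣ {suc n} S = ∣ S zero ∣ᵇ + ∣ S ∘ suc ∣

  ∣all∣ : ∣ (λ (_ : Fin n) → true) ∣ ≡ n
  ∣all∣ {zero}  = refl
  ∣all∣ {suc n} = cong suc ∣all∣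

  ∣∣-mono : S ⊆ P → ∣ S ∣ ≤ ∣ P ∣
  ∣∣-mono {zero} S⊆P = z≤n
  ∣∣-mono {suc n} {S} {P} S⊆P = +-mono-≤
    (∣∣ᵇ-mono (λ e → is-true (S⊆P (holds e))))
    (∣∣-mono {S = S ∘ suc} {P ∘ suc} λ (holds e) → holds (is-true (S⊆P (holds e))))

  ∣∣-split : ∀ (S P : VertexSet n) → ∣ S ∣ ≡ ∣ S ∩ P ∣ + ∣ S ∖ P ∣
  ∣∣-split {zero} S P = refl
  ∣∣-split {suc n} S P with S zero | P zero
  ... | true  | true  = cong suc (∣∣-split (S ∘ suc) (P ∘ suc))
  ... | true  | false = trans (cong suc (∣∣-split (S ∘ suc) (P ∘ suc))) (sym (+-suc _ _))
  ... | false | _     = ∣∣-split (S ∘ suc) (P ∘ suc)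

  ∣∣-pos : v ∈ S → 0 < ∣ S ∣
  ∣∣-pos {v = zero}  (holds v∈S) rewrite v∈S = s≤s z≤n
  ∣∣-pos {v = suc v} {S = S} (holds v∈S) = <-≤-trans (∣∣-pos {S = S ∘ suc} (holds v∈S)) (m≤n+m _ _)

  ∣∣-mono-< : S ⊆ P → v ∈ P → v ∉ S → ∣ S ∣ < ∣ P ∣
  ∣∣-mono-< {S = S} {P} S⊆P v∈P v∉S = begin-strict
    ∣ S ∣                 ≤⟨ ∣∣-mono (λ v∈S → ∈-∩ (S⊆P v∈S) v∈S) ⟩
    ∣ P ∩ S ∣             <⟨ m<m+n _ (∣∣-pos (∈-∖ v∈P v∉S)) ⟩
    ∣ P ∩ S ∣ + ∣ P ∖ S ∣ ≡⟨ ∣∣-split P S ⟨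
    ∣ P ∣                 ∎
    where open ≤-Reasoning

  ∣∖⁅⁆∣< : v ∈ S → ∣ S ∖ ⁅ v ⁆ ∣ < ∣ S ∣
  ∣∖⁅⁆∣< v∈S = ∣∣-mono-< (proj₁ ∘ ∈-∖⁻) v∈S λ v∈S∖v → proj₂ (∈-∖⁻ v∈S∖v) ∈⁅⁆

  ∣∣-disjoint : S ⊆ U → P ⊆ U → (∀ {v} → v ∈ S → v ∉ P) → ∣ S ∣ + ∣ P ∣ ≤ ∣ U ∣
  ∣∣-disjoint {S = S} {U} {P} S⊆U P⊆U S∩P=∅ = begin
    ∣ S ∣ + ∣ P ∣         ≤⟨ +-mono-≤ (∣∣-mono (λ v∈S → ∈-∩ (S⊆U v∈S) v∈S))
                                      (∣∣-mono λ v∈P → ∈-∖ (P⊆U v∈P) λ v∈S → S∩P=∅ v∈S v∈P) ⟩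
    ∣ U ∩ S ∣ + ∣ U ∖ S ∣ ≡⟨ ∣∣-split U S ⟨
    ∣ U ∣                 ∎
    where open ≤-Reasoning

  ∣∣-half : ∀ (S P : VertexSet n) → ∣ S ∣ < 2 * ∣ S ∩ P ∣ → 2 * ∣ S ∖ P ∣ ≤ ∣ S ∣
  ∣∣-half S P heavy = begin
    2 * b     ≡⟨ cong (b +_) (+-identityʳ b) ⟩
    b + b     ≤⟨ +-monoˡ-≤ b (<⇒≤ b<a) ⟩
    a + b     ≡⟨ ∣∣-split S P ⟨
    ∣ S ∣     ∎
    where
    open ≤-Reasoning
    a b : ℕ
    a = ∣ S ∩ P ∣
    b = ∣ S ∖ P ∣
    b<a : b < a
    b<a = +-cancelˡ-< a b a (begin-strict
      a + b   ≡⟨ ∣∣-split S P ⟨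
      ∣ S ∣   <⟨ heavy ⟩
      2 * a   ≡⟨ cong (a +_) (+-identityʳ a) ⟩
      a + a   ∎)

  ∣∣≤1⇒≡ : ∣ S ∣ ≤ 1 → u ∈ S → v ∈ S → u ≡ v
  ∣∣≤1⇒≡ {S = S} {u} {v} ∣S∣≤1 u∈S v∈S with u ≟ᶠ v
  ... | yes u≡v = u≡v
  ... | no u≢v = contradiction ∣S∣≤1 (<⇒≱ (begin-strict
    1                     <⟨ n<1+n 1 ⟩
    2                     ≤⟨ +-mono-≤ (∣∣-pos {S = ⁅ u ⁆} ∈⁅⁆) (∣∣-pos {S = ⁅ v ⁆} ∈⁅⁆) ⟩
    ∣ ⁅ u ⁆ ∣ + ∣ ⁅ v ⁆ ∣ ≤⟨ ∣∣-disjoint (λ w∈ → subst (_∈ S) (sym (∈⁅⁆⁻ w∈)) u∈S)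
                                        (λ w∈ → subst (_∈ S) (sym (∈⁅⁆⁻ w∈)) v∈S)
                                        (λ w∈u w∈v → u≢v (trans (sym (∈⁅⁆⁻ w∈u)) (∈⁅⁆⁻ w∈v))) ⟩
    ∣ S ∣                 ∎))
    where open ≤-Reasoning

module LoopErasure {A : Set} (_≟_ : DecidableEquality A) {R : A → A → Set} where

  vertices : ∀ {a b} → Star R a b → List A
  vertices {a} ε        = a ∷ []
  vertices {a} (_ ◅ xs) = a ∷ vertices xs

  private
    suffix : ∀ {a b c} (w : Star R a b) → Unique (vertices w) → _∈ₗ_ _≟_ c (vertices w) →
             Σ[ w′ ∈ Star R c b ] Unique (vertices w′)
    suffix ε        u       (here refl) = ε , u
    suffix (x ◅ xs) u       (here refl) = x ◅ xs , u
    suffix (_ ◅ xs) (_ ∷ u) (there c∈)  = suffix xs u c∈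

  erase : ∀ {a b} → Star R a b → Σ[ w ∈ Star R a b ] Unique (vertices w)
  erase ε = ε , (All.[] ∷ [])
  erase {a} (x ◅ xs) with erase xs
  ... | w , u with _∈ₗ?_ _≟_ a (vertices w)
  ...   | yes a∈w = suffix w u a∈w
  ...   | no  a∉w = x ◅ w , (¬Any⇒All¬ _ a∉w ∷ u)

  vertices-linked : ∀ {S : A → A → Set} → (∀ {a b} → R a b → S a b) →
                    ∀ {a b} (w : Star R a b) → Linked S (vertices w)
  vertices-linked f ε            = [-]
  vertices-linked f (x ◅ ε)      = f x ∷ [-]
  vertices-linked f (x ◅ y ◅ xs) = f x ∷ vertices-linked f (y ◅ xs)

  last-vertices : ∀ {a b} (w : Star R a b) → last (vertices w) ≡ just b
  last-vertices ε            = refl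
  last-vertices (x ◅ ε)      = refl
  last-vertices (x ◅ y ◅ xs) = last-vertices (y ◅ xs)

  1≤length-vertices : ∀ {a b} (w : Star R a b) → 1 ≤ length (vertices w)
  1≤length-vertices ε       = s≤s z≤n
  1≤length-vertices (_ ◅ _) = s≤s z≤n

module _ {n : ℕ} (G : Graph n) where

  open LoopErasure (_≟ᶠ_ {n})

  Edge : Fin n → Fin n → Set
  Edge u v = adj G u v ≡ true

  Edge-sym : ∀ {u v} → Edge u v → Edge v u
  Edge-sym {u} {v} uv = trans (Graph.sym G v u) uv

  EdgeOtherThan : Fin n → Fin n → Fin n → Fin n → Set
  EdgeOtherThan x y u v = Edge u v × ¬ (u ≡ x × v ≡ y) × ¬ (u ≡ y × v ≡ x)

  EdgeOtherThan-sym : ∀ {x y u v} → EdgeOtherThan x y u v → EdgeOtherThan x y v u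
  EdgeOtherThan-sym (uv , ¬xy , ¬yx) =
    Edge-sym uv , (λ (v≡x , u≡y) → ¬yx (u≡y , v≡x)) , (λ (v≡y , u≡x) → ¬xy (u≡x , v≡y))

  -- Erasing the loops of such a walk and closing it with the edge yx gives a cycle.
  no-detour : Acyclic G → ∀ {x y} → Edge x y → ¬ Star (EdgeOtherThan x y) x y
  no-detour acyclic {x} {y} xy detour with erase detour
  ... | ε , _         = contradiction (trans (sym xy) (Graph.irrefl G x)) λ ()
  ... | e ◅ ε , _     = proj₁ (proj₂ e) (refl , refl)
  ... | e ◅ e′ ◅ w , unique = acyclic (vertices (e ◅ e′ ◅ w))
    ( s≤s (s≤s (1≤length-vertices w)) , unique , vertices-linked proj₁ (e ◅ e′ ◅ w)
    , λ z last≡z → subst (λ v → Edge v x)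
                         (just-injective (trans (sym (last-vertices (e ◅ e′ ◅ w))) last≡z)) (Edge-sym xy))

upward : ∀ {P : ℕ → Set} → (∀ {i} → P i → P (suc i)) → ∀ {i j} → i ≤ j → P i → P j
upward up {j = zero}  z≤n   p = p
upward up {j = suc j} i≤1+j p with m≤n⇒m<n∨m≡n i≤1+j
... | inj₂ refl      = p
... | inj₁ (s≤s i≤j) = up (upward up i≤j p)

least : ∀ {P : ℕ → Set} → (∀ i → Dec (P i)) → (∀ {i} → P i → P (suc i)) →
        ∀ {j} → P j → Σ[ i ∈ ℕ ] P i × (∀ {i′} → P i′ → i ≤ i′)
least P? up {zero}  p = 0 , p , λ _ → z≤n
least P? up {suc j} p with P? j
... | yes pj = least P? up pj
... | no ¬pj = suc j , p , λ pi′ → ≰⇒> λ i′≤j → ¬pj (upward up i′≤j pi′)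

record Rooting {n : ℕ} (G : Graph n) : Set where
  field
    root           : Fin n
    parent         : Fin n → Fin n
    depth          : Fin n → ℕ
    depth-root     : depth root ≡ 0
    depth≡0⇒root   : ∀ {v} → depth v ≡ 0 → v ≡ root
    depth-parent   : ∀ {v} → v ≢ root → suc (depth (parent v)) ≡ depth v
    edge-to-parent : ∀ {u v} → Edge G u v → (u ≢ root × parent u ≡ v) ⊎ (v ≢ root × parent v ≡ u)

module BreadthFirst {n : ℕ} (G : Graph n) (connected : Connected G) (root : Fin n) where

  neighbours : VertexSet n → VertexSet n
  neighbours S v = does (any? λ u → adj G u v ∧ S u ≟ᵇ true)

  Ball : ℕ → VertexSet n
  Ball zero      = ⁅ root ⁆
  Ball (suc j) v = Ball j v ∨ neighbours (Ball j) v

  Ball-suc : ∀ j {v} → v ∈ Ball j → v ∈ Ball (suc j)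
  Ball-suc j {v} (holds v∈) = holds (cong (_∨ neighbours (Ball j) v) v∈)

  Ball-step : ∀ j {u v} → u ∈ Ball j → Edge G u v → v ∈ Ball (suc j)
  Ball-step j {u} {v} (holds u∈) uv =
    holds (trans (cong (Ball j v ∨_) (dec-true (any? _) (u , cong₂ _∧_ uv u∈))) (∨-zeroʳ _))

  Ball-suc⁻ : ∀ j {v} → v ∈ Ball (suc j) → v ∈ Ball j ⊎ Σ[ u ∈ Fin n ] Edge G u v × u ∈ Ball j
  Ball-suc⁻ j {v} (holds v∈) with Ball j v in eq
  ... | true  = inj₁ (holds eq)
  ... | false with any? (λ u → adj G u v ∧ Ball j u ≟ᵇ true) | v∈
  ...   | yes (u , e) | _ with adj G u v in uv
  ...     | true = inj₂ (u , uv , holds e)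

  reachable : ∀ j {u v} → Walk G u v → u ∈ Ball j → Σ[ i ∈ ℕ ] v ∈ Ball i
  reachable j here         u∈ = j , u∈
  reachable j (step uw w) u∈ = reachable (suc j) w (Ball-step j u∈ uw)

  private
    depth-spec : ∀ v → Σ[ i ∈ ℕ ] v ∈ Ball i × (∀ {j} → v ∈ Ball j → i ≤ j)
    depth-spec v = let (j , v∈Ball-j) = reachable 0 (connected root v) ∈⁅⁆
                 in least (λ j → v ∈? Ball j) (λ {j} → Ball-suc j) {j} v∈Ball-j

  depth : Fin n → ℕ
  depth v = proj₁ (depth-spec v)

  ∈Ball-depth : ∀ v → v ∈ Ball (depth v)
  ∈Ball-depth v = proj₁ (proj₂ (depth-spec v))

  depth-minimal : ∀ {v} j → v ∈ Ball j → depth v ≤ j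
  depth-minimal {v} j = proj₂ (proj₂ (depth-spec v)) {j}

  depth-root : depth root ≡ 0
  depth-root = n≤0⇒n≡0 (depth-minimal 0 ∈⁅⁆)

  depth≡0⇒root : ∀ {v} → depth v ≡ 0 → v ≡ root
  depth≡0⇒root {v} d≡0 = ∈⁅⁆⁻ (subst (λ i → v ∈ Ball i) d≡0 (∈Ball-depth v))

  parent-spec : ∀ v → v ≡ root ⊎ Σ[ u ∈ Fin n ] Edge G u v × suc (depth u) ≡ depth v
  parent-spec v with depth v in eq | ∈Ball-depth v
  ... | zero  | _ = inj₁ (depth≡0⇒root eq)
  ... | suc i | v∈ with Ball-suc⁻ i v∈
  ...   | inj₁ v∈Ball-i = contradiction (subst (_≤ i) eq (depth-minimal i v∈Ball-i)) (<-irrefl refl)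
  ...   | inj₂ (u , uv , u∈Ball-i) = inj₂ (u , uv , cong suc depth-u≡i)
    where
    depth-u≡i : depth u ≡ i
    depth-u≡i = ≤-antisym (depth-minimal i u∈Ball-i)
                          (≤-pred (subst (_≤ suc (depth u)) eq (depth-minimal _ (Ball-step (depth u) (∈Ball-depth u) uv))))

  parent : Fin n → Fin n
  parent v with parent-spec v
  ... | inj₁ _       = v
  ... | inj₂ (u , _) = u

  parent-edge : ∀ {v} → v ≢ root → Edge G (parent v) v × suc (depth (parent v)) ≡ depth v
  parent-edge {v} v≢root with parent-spec v
  ... | inj₁ v≡root         = contradiction v≡root v≢root
  ... | inj₂ (_ , uv , d) = uv , d

  module _ (acyclic : Acyclic G) where

    edge-to-parent : ∀ {x y} → Edge G x y → (x ≢ root × parent x ≡ y) ⊎ (y ≢ root × parent y ≡ x)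
    edge-to-parent {x} {y} xy with ¬? (x ≟ᶠ root) ×-dec (parent x ≟ᶠ y) | ¬? (y ≟ᶠ root) ×-dec (parent y ≟ᶠ x)
    ... | yes x→y | _       = inj₁ x→y
    ... | no _    | yes y→x = inj₂ y→x
    -- Otherwise the paths from x and from y up to the root avoid the edge xy.
    ... | no ¬x→y | no ¬y→x =
      contradiction (climb _ x refl ◅◅ reverse (EdgeOtherThan-sym G) (climb _ y refl)) (no-detour G acyclic xy)
      where
      climb : ∀ d v → depth v ≡ d → Star (EdgeOtherThan G x y) v root
      climb zero    v d≡0 = subst (λ u → Star _ u root) (sym (depth≡0⇒root d≡0)) ε
      climb (suc d) v eq  = v→parent ◅ climb d (parent v) (suc-injective (trans (proj₂ (parent-edge v≢root)) eq))
        where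
        v≢root : v ≢ root
        v≢root refl = 0≢1+n (trans (sym depth-root) eq)
        v→parent : EdgeOtherThan G x y v (parent v)
        v→parent = Edge-sym G (proj₁ (parent-edge v≢root))
                 , (λ { (refl , refl) → ¬x→y (v≢root , refl) })
                 , (λ { (refl , refl) → ¬y→x (v≢root , refl) })

    rooting : Rooting G
    rooting = record
      { root = root ; parent = parent ; depth = depth
      ; depth-root = depth-root ; depth≡0⇒root = depth≡0⇒root
      ; depth-parent = λ v≢root → proj₂ (parent-edge v≢root)
      ; edge-to-parent = edge-to-parent
      }

module Components {n : ℕ} {G : Graph n} (ρ : Rooting G) where

  open Rooting ρ

  private variable
    S S′ Z : VertexSet n
    a u v w : Fin n

  non-root : ∀ {v d} → depth v ≡ suc d → v ≢ root
  non-root d≡1+d refl = 0≢1+n (trans (sym depth-root) d≡1+d)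

  rooted-induction : (P : Fin n → Set) → P root → (∀ {v} → v ≢ root → P (parent v) → P v) → ∀ v → P v
  rooted-induction P at-root from-parent v = go (depth v) v refl
    where
    go : ∀ d v → depth v ≡ d → P v
    go zero    v d≡0 = subst P (sym (depth≡0⇒root d≡0)) at-root
    go (suc d) v eq  = from-parent (non-root eq) (go d (parent v) (suc-injective (trans (depth-parent (non-root eq)) eq)))

  private
    climbIn : VertexSet n → ℕ → Fin n → Fin n
    climbIn S zero    v = v
    climbIn S (suc d) v = if S (parent v) then climbIn S d (parent v) else v

  -- For v ∈ S, top S v is the vertex of the component of v in G[S] that is
  -- closest to the root: climb from v through parents while they lie in S.
  top : VertexSet n → Fin n → Fin n
  top S v = climbIn S (depth v) v

  top-root : top S root ≡ root
  top-root {S = S} = subst (λ d → climbIn S d root ≡ root) (sym depth-root) refl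

  top-unfold : v ≢ root → top S v ≡ (if S (parent v) then top S (parent v) else v)
  top-unfold {v} {S} v≢root =
    subst (λ d → climbIn S d v ≡ (if S (parent v) then top S (parent v) else v)) (depth-parent v≢root) refl

  top-climb : v ≢ root → parent v ∈ S → top S v ≡ top S (parent v)
  top-climb {v} {S} v≢root (holds p) =
    trans (top-unfold v≢root) (cong (λ b → if b then top S (parent v) else v) p)

  top-stop : v ≢ root → parent v ∉ S → top S v ≡ v
  top-stop {v} {S} v≢root p∉S =
    trans (top-unfold v≢root) (cong (λ b → if b then top S (parent v) else v) (∉⇒≡false p∉S))

  top-∈ : v ∈ S → top S v ∈ S
  top-∈ {v} {S} = rooted-induction (λ v → v ∈ S → top S v ∈ S) (subst (_∈ S) (sym top-root)) from-parent v
    where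
    from-parent : ∀ {v} → v ≢ root → (parent v ∈ S → top S (parent v) ∈ S) → v ∈ S → top S v ∈ S
    from-parent {v} v≢root ih v∈S with parent v ∈? S
    ... | yes p∈S = subst (_∈ S) (sym (top-climb v≢root p∈S)) (ih p∈S)
    ... | no  p∉S = subst (_∈ S) (sym (top-stop v≢root p∉S)) v∈S

  top-edge : u ∈ S → v ∈ S → Edge G u v → top S u ≡ top S v
  top-edge u∈S v∈S uv with edge-to-parent uv
  ... | inj₁ (u≢root , refl) = top-climb u≢root v∈S
  ... | inj₂ (v≢root , refl) = sym (top-climb v≢root u∈S)

  ParentClosed : VertexSet n → VertexSet n → Set
  ParentClosed Z S = ∀ {w} → w ∈ Z → w ≢ root → parent w ∈ S → parent w ∈ Z

  top-⊆ : S′ ⊆ S → ParentClosed S′ S → w ∈ S′ → top S′ w ≡ top S w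
  top-⊆ {S′} {S} {w} S′⊆S closed =
    rooted-induction (λ w → w ∈ S′ → top S′ w ≡ top S w) (λ _ → trans top-root (sym top-root)) from-parent w
    where
    from-parent : ∀ {w} → w ≢ root → (parent w ∈ S′ → top S′ (parent w) ≡ top S (parent w)) →
           w ∈ S′ → top S′ w ≡ top S w
    from-parent {w} w≢root ih w∈S′ with parent w ∈? S
    ... | yes p∈S = let p∈S′ = closed w∈S′ w≢root p∈S in
                    trans (top-climb w≢root p∈S′) (trans (ih p∈S′) (sym (top-climb w≢root p∈S)))
    ... | no  p∉S = trans (top-stop w≢root (p∉S ∘ S′⊆S)) (sym (top-stop w≢root p∉S))

  data Below (S : VertexSet n) (a : Fin n) : Fin n → Set where
    here : Below S a a
    up   : ∀ {w} → w ≢ root → parent w ∈ S → Below S a (parent w) → Below S a w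

  below? : ∀ S a w → Dec (Below S a w)
  below? S a = rooted-induction (λ w → Dec (Below S a w)) at-root from-parent
    where
    at-root : Dec (Below S a root)
    at-root with root ≟ᶠ a
    ... | yes refl = yes here
    ... | no  r≢a  = no λ { here → r≢a refl ; (up r≢r _ _) → r≢r refl }
    from-parent : ∀ {w} → w ≢ root → Dec (Below S a (parent w)) → Dec (Below S a w)
    from-parent {w} w≢root below-parent? with w ≟ᶠ a | parent w ∈? S ×-dec below-parent?
    ... | yes refl | _                 = yes here
    ... | no  _    | yes (p∈S , below) = yes (up w≢root p∈S below)
    ... | no  w≢a  | no ¬up            = no λ { here → w≢a refl ; (up _ p∈S below) → ¬up (p∈S , below) }

  below-top : ∀ w → Below S (top S w) w
  below-top {S} =
    rooted-induction (λ w → Below S (top S w) w) (subst (λ t → Below S t root) (sym top-root) here) from-parent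
    where
    from-parent : ∀ {w} → w ≢ root → Below S (top S (parent w)) (parent w) → Below S (top S w) w
    from-parent {w} w≢root below with parent w ∈? S
    ... | yes p∈S = subst (λ t → Below S t w) (sym (top-climb w≢root p∈S)) (up w≢root p∈S below)
    ... | no  p∉S = subst (λ t → Below S t w) (sym (top-stop w≢root p∉S)) here

  Below-mono : S′ ⊆ S → Below S′ a w → Below S a w
  Below-mono S′⊆S here                  = here
  Below-mono S′⊆S (up w≢root p∈S below) = up w≢root (S′⊆S p∈S) (Below-mono S′⊆S below)

  Child : Fin n → Fin n → Set
  Child c t = t ≢ root × parent t ≡ c

  child? : ∀ c t → Dec (Child c t)
  child? c t = ¬? (t ≟ᶠ root) ×-dec (parent t ≟ᶠ c)

  Below⇒child-top : ∀ {c} → Below S c w → w ≢ c → Child c (top (S ∖ ⁅ c ⁆) w)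
  Below⇒child-top here w≢c = contradiction refl w≢c
  Below⇒child-top {S = S} {c = c} (up {w} w≢root p∈S below) w≢c with parent w ≟ᶠ c
  ... | yes refl = subst (Child c) (sym (top-stop w≢root λ p∈S∖c → proj₂ (∈-∖⁻ p∈S∖c) ∈⁅⁆)) (w≢root , refl)
  ... | no  p≢c  = subst (Child c) (sym (top-climb w≢root (∈-∖ p∈S (p≢c ∘ ∈⁅⁆⁻))))
                         (Below⇒child-top below p≢c)

  subtree : VertexSet n → Fin n → VertexSet n
  subtree S a = S ∩ ⟦ below? S a ⟧

  sameTop : VertexSet n → Fin n → VertexSet n
  sameTop S v = ⟦ (λ w → top S w ≟ᶠ top S v) ⟧

  component remainder : VertexSet n → Fin n → VertexSet n
  component S v = S ∩ sameTop S v
  remainder S v = S ∖ sameTop S v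

  ∈-component : w ∈ S → top S w ≡ top S v → w ∈ component S v
  ∈-component {S = S} {v = v} w∈S eq = ∈-∩ w∈S (∈⟦⟧ {P? = λ w → top S w ≟ᶠ top S v} eq)

  ∈-component⁻ : w ∈ component S v → w ∈ S × top S w ≡ top S v
  ∈-component⁻ {S = S} {v = v} w∈ =
    let (w∈S , same) = ∈-∩⁻ w∈ in w∈S , ∈⟦⟧⁻ {P? = λ w → top S w ≟ᶠ top S v} same

  ∈-remainder⁻ : w ∈ remainder S v → w ∈ S × top S w ≢ top S v
  ∈-remainder⁻ {S = S} {v = v} w∈ =
    let (w∈S , other) = ∈-∖⁻ w∈ in w∈S , other ∘ ∈⟦⟧ {P? = λ w → top S w ≟ᶠ top S v}

  component-or-remainder : ∀ v → w ∈ S → w ∈ component S v ⊎ w ∈ remainder S v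
  component-or-remainder {w} {S} v w∈S with top S w ≟ᶠ top S v
  ... | yes same  = inj₁ (∈-component w∈S same)
  ... | no  other = inj₂ (∈-∖ w∈S (other ∘ ∈⟦⟧⁻ {P? = λ w → top S w ≟ᶠ top S v}))

  component-remainder-apart : u ∈ component S v → w ∈ remainder S v → u ≢ w × ¬ Edge G u w
  component-remainder-apart u∈ w∈ =
    let (u∈S , u-top) = ∈-component⁻ u∈ ; (w∈S , w-other) = ∈-remainder⁻ w∈ in
    (λ { refl → w-other u-top }) , λ uw → w-other (trans (sym (top-edge u∈S w∈S uw)) u-top)

  component-closed : ∀ v → ParentClosed (component S v) S
  component-closed v w∈ w≢root p∈S =
    ∈-component p∈S (trans (sym (top-climb w≢root p∈S)) (proj₂ (∈-component⁻ w∈)))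

  remainder-closed : ∀ v → ParentClosed (remainder S v) S
  remainder-closed {S = S} v w∈ w≢root p∈S =
    ∈-∖ p∈S λ same → proj₂ (∈-remainder⁻ w∈)
      (trans (top-climb w≢root p∈S) (∈⟦⟧⁻ {P? = λ w → top S w ≟ᶠ top S v} same))

  component-mono : Z ⊆ S → ParentClosed Z S → v ∈ Z → component Z v ⊆ component S v
  component-mono Z⊆S closed v∈Z w∈ =
    let (w∈Z , same) = ∈-component⁻ w∈ in
    ∈-component (Z⊆S w∈Z) (trans (sym (top-⊆ Z⊆S closed w∈Z)) (trans same (top-⊆ Z⊆S closed v∈Z)))

  component⊆subtree : Z ⊆ S → component Z v ⊆ subtree S (top Z v)
  component⊆subtree {Z} {S} {v} Z⊆S {w} w∈ =
    let (w∈Z , same) = ∈-component⁻ w∈ in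
    ∈-∩ (Z⊆S w∈Z)
        (∈⟦⟧ {P? = below? S (top Z v)} (Below-mono Z⊆S (subst (λ t → Below Z t w) same (below-top w))))

  Connected-in : VertexSet n → Set
  Connected-in S = ∀ {u v} → u ∈ S → v ∈ S → top S u ≡ top S v

  component-connected : ∀ v → Connected-in (component S v)
  component-connected {S} v u∈ w∈ = trans (top-≡ u∈) (sym (top-≡ w∈))
    where
    top-≡ : ∀ {x} → x ∈ component S v → top (component S v) x ≡ top S v
    top-≡ x∈ = trans (top-⊆ (proj₁ ∘ ∈-component⁻) (component-closed v) x∈) (proj₂ (∈-component⁻ x∈))

  Heavy : VertexSet n → Fin n → Set
  Heavy S a = a ∈ S × ∣ S ∣ < 2 * ∣ subtree S a ∣

  heavy? : ∀ S a → Dec (Heavy S a)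
  heavy? S a = (a ∈? S) ×-dec (∣ S ∣ <? 2 * ∣ subtree S a ∣)

  -- A component of S ∖ {c} either hangs from a child of c or avoids the subtree of c.
  balanced-at : ∀ {c} → Heavy S c → (∀ {t} → t ∈ S → Child c t → 2 * ∣ subtree S t ∣ ≤ ∣ S ∣) →
                v ∈ S ∖ ⁅ c ⁆ → 2 * ∣ component (S ∖ ⁅ c ⁆) v ∣ ≤ ∣ S ∣
  balanced-at {S} {v} {c} c-heavy child-light v∈S∖c with child? c (top (S ∖ ⁅ c ⁆) v)
  ... | yes child = ≤-trans (*-monoʳ-≤ 2 (∣∣-mono (component⊆subtree (proj₁ ∘ ∈-∖⁻))))
                            (child-light (proj₁ (∈-∖⁻ (top-∈ v∈S∖c))) child)
  ... | no not-child = ≤-trans (*-monoʳ-≤ 2 (∣∣-mono outside)) (∣∣-half S ⟦ below? S c ⟧ (proj₂ c-heavy))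
    where
    outside : component (S ∖ ⁅ c ⁆) v ⊆ S ∖ ⟦ below? S c ⟧
    outside w∈ = let (w∈S∖c , same) = ∈-component⁻ w∈ ; (w∈S , w∉c) = ∈-∖⁻ w∈S∖c in
      ∈-∖ w∈S λ below-c → not-child
        (subst (Child c) same (Below⇒child-top (∈⟦⟧⁻ {P? = below? S c} below-c) (∉⁅⁆⇒≢ w∉c)))

  -- The deepest heavy vertex; the top of the connected set S is heavy.
  centroid : v ∈ S → Connected-in S →
             Σ[ c ∈ Fin n ] c ∈ S × (∀ {v} → v ∈ S ∖ ⁅ c ⁆ → 2 * ∣ component (S ∖ ⁅ c ⁆) v ∣ ≤ ∣ S ∣)
  centroid {v₀} {S} v₀∈S connected = c , proj₁ c-heavy , balanced-at c-heavy child-light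
    where
    weight : Fin n → ℕ
    weight a = if does (heavy? S a) then suc (depth a) else 0

    weight-heavy : ∀ {a} → Heavy S a → weight a ≡ suc (depth a)
    weight-heavy {a} heavy = cong (λ b → if b then suc (depth a) else 0) (dec-true (heavy? S a) heavy)

    weight-light : ∀ {a} → ¬ Heavy S a → weight a ≡ 0
    weight-light {a} light = cong (λ b → if b then suc (depth a) else 0) (dec-false (heavy? S a) light)

    r : Fin n
    r = top S v₀

    r-heavy : Heavy S r
    r-heavy = top-∈ v₀∈S , (begin-strict
      ∣ S ∣               <⟨ m<m+n ∣ S ∣ (∣∣-pos v₀∈S) ⟩
      ∣ S ∣ + ∣ S ∣       ≡⟨ cong (∣ S ∣ +_) (+-identityʳ ∣ S ∣) ⟨
      2 * ∣ S ∣           ≤⟨ *-monoʳ-≤ 2 (∣∣-mono (λ w∈S → component⊆subtree id (∈-component w∈S (connected w∈S v₀∈S)))) ⟩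
      2 * ∣ subtree S r ∣ ∎)
      where open ≤-Reasoning

    c : Fin n
    c = argmax weight r (allFin n)

    c-heaviest : ∀ a → weight a ≤ weight c
    c-heaviest a = All.lookup (f[xs]≤f[argmax] {f = weight} r (allFin n)) (∈-allFin a)

    c-heavy : Heavy S c
    c-heavy = decided (heavy? S c)
      where
      decided : Dec (Heavy S c) → Heavy S c
      decided (yes heavy) = heavy
      decided (no  light) = ⊥-elim (<-irrefl refl (begin-strict
        0                 <⟨ s≤s z≤n ⟩
        suc (depth r)     ≡⟨ weight-heavy r-heavy ⟨
        weight r          ≤⟨ f[⊥]≤f[argmax] {f = weight} r (allFin n) ⟩
        weight c          ≡⟨ weight-light light ⟩
        0                 ∎))
        where open ≤-Reasoning

    child-light : ∀ {t} → t ∈ S → Child c t → 2 * ∣ subtree S t ∣ ≤ ∣ S ∣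
    child-light {t} t∈S (t≢root , pt≡c) = ≮⇒≥ λ t-heavy → <-irrefl refl (begin-strict
      depth c               ≡⟨ cong depth pt≡c ⟨
      depth (parent t)      <⟨ ≤-reflexive (depth-parent t≢root) ⟩
      depth t               ≤⟨ ≤-pred (subst₂ _≤_ (weight-heavy (t∈S , t-heavy)) (weight-heavy c-heavy) (c-heaviest t)) ⟩
      depth c               ∎)
      where open ≤-Reasoning

  full-connected : Connected-in (λ _ → true)
  full-connected {u} {v} _ _ = trans (top-full u) (sym (top-full v))
    where
    top-full : ∀ w → top (λ _ → true) w ≡ root
    top-full = rooted-induction (λ w → top (λ _ → true) w ≡ root) top-root
                                (λ w≢root ih → trans (top-climb w≢root (holds refl)) ih)

module Localization {n : ℕ} (G : Graph n) where

  private variable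
    k t M : ℕ
    S X Y : VertexSet n
    c u v : Fin n
    r r′ : ℕ → Fin n

  probe-self : ∀ u → probe G u u ≡ r0
  probe-self u with u ≟ᶠ u
  ... | yes _   = refl
  ... | no u≢u = contradiction refl u≢u

  probe-≡ : u ≡ v → probe G v u ≡ r0
  probe-≡ {u} refl = probe-self u

  probe-r0⇒≡ : probe G u v ≡ r0 → u ≡ v
  probe-r0⇒≡ {u} {v} p with u ≟ᶠ v
  ... | yes u≡v = u≡v
  ... | no  _ with adj G u v
  ...   | true  = contradiction p λ ()
  ...   | false = contradiction p λ ()

  probe-adj≢r* : Edge G u v → probe G u v ≢ r*
  probe-adj≢r* {u} {v} uv with u ≟ᶠ v
  ... | yes _ = λ ()
  ... | no  _ rewrite uv = λ ()

  probe-r* : u ≢ v → ¬ Edge G u v → probe G u v ≡ r*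
  probe-r* {u} {v} u≢v ¬uv with u ≟ᶠ v
  ... | yes u≡v = contradiction u≡v u≢v
  ... | no _ rewrite ¬-not ¬uv = refl

  -- Strategies built below are oblivious: the probes of each round are fixed in
  -- advance, and `nothing` means that the cop does not probe in that round.
  Schedule : ℕ → Set
  Schedule k = ℕ → Fin k → Maybe (Fin n)

  answer : Maybe (Fin n) → Fin n → Resp
  answer nothing  _ = r*
  answer (just u) v = probe G u v

  Moves : (ℕ → Fin n) → ℕ → Set
  Moves r s = r (suc s) ≡ r s ⊎ Edge G (r s) (r (suc s))

  Confined : VertexSet n → ℕ → (ℕ → Fin n) → Set
  Confined S t r = (∀ {s} → s ≤ t → r s ∈ S) × (∀ {s} → s < t → Moves r s)

  Indistinguishable : Schedule k → ℕ → (ℕ → Fin n) → (ℕ → Fin n) → Set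
  Indistinguishable P t r r′ = ∀ {s} → s ≤ t → ∀ i → answer (P s i) (r s) ≡ answer (P s i) (r′ s)

  Detected : Schedule k → ℕ → (ℕ → Fin n) → Set
  Detected {k} P t r = Σ[ s ∈ ℕ ] s ≤ t × Σ[ i ∈ Fin k ] answer (P s i) (r s) ≢ r*

  Located : VertexSet n → Schedule k → ℕ → (ℕ → Fin n) → Set
  Located S P t r = ∀ r′ → Confined S t r′ → Indistinguishable P t r r′ → r′ t ≡ r t

  ProbesWithin : VertexSet n → Schedule k → Set
  ProbesWithin S P = ∀ s i {u} → P s i ≡ just u → u ∈ S

  Locates : VertexSet n → ℕ → ℕ → Set
  Locates S k M = Σ[ P ∈ Schedule k ]
    (∀ r → Confined S M r → Σ[ t ∈ ℕ ] t ≤ M × Located S P t r)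

  -- Probing only inside S and hearing the robber before locating it is what
  -- allows sweeps of mutually invisible regions to be run one after another.
  Sweeps : VertexSet n → ℕ → ℕ → Set
  Sweeps S k M = Σ[ P ∈ Schedule k ] ProbesWithin S P ×
    (∀ r → Confined S M r → Σ[ t ∈ ℕ ] t ≤ M × Detected P t r × Located S P t r)

  Confined-≤ : t ≤ M → Confined S M r → Confined S t r
  Confined-≤ t≤M (r∈S , moves) = (λ s≤t → r∈S (≤-trans s≤t t≤M)) , (λ s<t → moves (<-≤-trans s<t t≤M))

  Indistinguishable-≤ : {P : Schedule k} → t ≤ M → Indistinguishable P M r r′ → Indistinguishable P t r r′
  Indistinguishable-≤ t≤M same s≤t = same (≤-trans s≤t t≤M)

  Indistinguishable-sym : {P : Schedule k} → Indistinguishable P t r r′ → Indistinguishable P t r′ r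
  Indistinguishable-sym same s≤t i = sym (same s≤t i)

  Sweeps⇒Locates : Sweeps S k M → Locates S k M
  Sweeps⇒Locates (P , _ , sweep) = P , λ r confined →
    let (t , t≤M , _ , located) = sweep r confined in t , t≤M , located

  idle : Schedule k
  idle _ _ = nothing

  sweep-∅ : (∀ v → v ∉ S) → Sweeps S k 0
  sweep-∅ S=∅ = idle , (λ _ _ ()) , λ r (r∈S , _) → contradiction (r∈S z≤n) (S=∅ (r 0))

  locate-≤1 : (∀ {u v} → u ∈ S → v ∈ S → u ≡ v) → Locates S k 0
  locate-≤1 S≤1 = idle , λ r (r∈S , _) → 0 , z≤n , λ r′ (r′∈S , _) _ → S≤1 (r′∈S z≤n) (r∈S z≤n)

  guard : Fin n → Schedule k → Schedule (suc k)
  guard c P s zero    = just c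
  guard c P s (suc i) = P s i

  guard-sees : {P : Schedule k} → Indistinguishable (guard c P) t r r′ → r′ t ≡ c → r t ≡ c
  guard-sees same r′t≡c = sym (probe-r0⇒≡ (trans (same ≤-refl zero) (probe-≡ r′t≡c)))

  visits-or-avoids : ∀ (r : ℕ → Fin n) c M → (Σ[ s ∈ ℕ ] s ≤ M × r s ≡ c) ⊎ (∀ {s} → s ≤ M → r s ≢ c)
  visits-or-avoids r c M with anyUpTo? (λ s → r s ≟ᶠ c) (suc M)
  ... | yes (s , s<1+M , rs≡c) = inj₁ (s , ≤-pred s<1+M , rs≡c)
  ... | no never = inj₂ λ s≤M rs≡c → never (_ , s≤s s≤M , rs≡c)

  guard-detects : {P : Schedule k} → r t ≡ c → Detected (guard c P) t r
  guard-detects {t = t} rt≡c = t , ≤-refl , zero , λ r0≡r* → contradiction (trans (sym (probe-≡ rt≡c)) r0≡r*) λ ()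

  guard-locates-at : {P : Schedule k} → r t ≡ c → Located S (guard c P) t r
  guard-locates-at rt≡c r′ _ same =
    trans (sym (probe-r0⇒≡ (trans (sym (same ≤-refl zero)) (probe-≡ rt≡c)))) (sym rt≡c)

  guard-avoiding : (∀ {s} → s ≤ M → r s ≢ c) → Confined S M r → Confined (S ∖ ⁅ c ⁆) M r
  guard-avoiding avoid (r∈S , moves) = (λ s≤M → ∈-∖ (r∈S s≤M) λ rs∈c → avoid s≤M (∈⁅⁆⁻ rs∈c)) , moves

  guard-located : {P : Schedule k} → (∀ {s} → s ≤ t → r s ≢ c) →
                  Located (S ∖ ⁅ c ⁆) P t r → Located S (guard c P) t r
  guard-located {c = c} {P = P} avoid located r′ confined same =
    located r′ (guard-avoiding r′-avoids confined) (λ s≤t i → same s≤t (suc i))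
    where
    r′-avoids : ∀ {s} → s ≤ _ → r′ s ≢ c
    r′-avoids s≤t r′s≡c = avoid s≤t (guard-sees {P = P} (Indistinguishable-≤ {P = guard c P} s≤t same) r′s≡c)

  guard-sweeps : c ∈ S → Sweeps (S ∖ ⁅ c ⁆) k M → Sweeps S (suc k) M
  guard-sweeps {c = c} {M = M} c∈S (P , within , sweep) = guard c P , within′ , sweep′
    where
    within′ : ProbesWithin _ (guard c P)
    within′ s zero    refl = c∈S
    within′ s (suc i) eq   = proj₁ (∈-∖⁻ (within s i eq))
    sweep′ : ∀ r → Confined _ M r → _
    sweep′ r confined with visits-or-avoids r c M
    ... | inj₁ (s , s≤M , rs≡c) = s , s≤M , guard-detects rs≡c , guard-locates-at rs≡c
    ... | inj₂ avoid with sweep r (guard-avoiding avoid confined)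
    ...   | t , t≤M , (s , s≤t , i , heard) , located =
            t , t≤M , (s , s≤t , suc i , heard) , guard-located (λ s≤t → avoid (≤-trans s≤t t≤M)) located

  guard-locates : Locates (S ∖ ⁅ c ⁆) k M → Locates S (suc k) M
  guard-locates {c = c} {M = M} (P , locate) = guard c P , locate′
    where
    locate′ : ∀ r → Confined _ M r → _
    locate′ r confined with visits-or-avoids r c M
    ... | inj₁ (s , s≤M , rs≡c) = s , s≤M , guard-locates-at rs≡c
    ... | inj₂ avoid with locate r (guard-avoiding avoid confined)
    ...   | t , t≤M , located = t , t≤M , guard-located (λ s≤t → avoid (≤-trans s≤t t≤M)) located

  Separated : VertexSet n → VertexSet n → Set
  Separated X Y = ∀ {u v} → u ∈ X → v ∈ Y → probe G u v ≡ r*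

  stays-in : (∀ {u v} → u ∈ X → v ∈ S → Edge G u v → v ∈ X) →
             Confined S t r → r 0 ∈ X → Confined X t r
  stays-in {X = X} {r = r} closed (r∈S , moves) r0∈X = r∈X , moves
    where
    r∈X : ∀ {s} → s ≤ _ → r s ∈ X
    r∈X {zero}  _   = r0∈X
    r∈X {suc s} s<t with moves s<t
    ... | inj₁ stay = subst (_∈ X) (sym stay) (r∈X (<⇒≤ s<t))
    ... | inj₂ move = closed (r∈X (<⇒≤ s<t)) (r∈S s<t) move

  sequence : ℕ → Schedule k → Schedule k → Schedule k
  sequence M PX PY s with s ≤? M
  ... | yes _ = PX s
  ... | no  _ = PY (s ∸ suc M)

  sequence-early : ∀ (PX PY : Schedule k) {s} → s ≤ M → sequence M PX PY s ≡ PX s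
  sequence-early {M = M} PX PY {s} s≤M with s ≤? M
  ... | yes _   = refl
  ... | no s≰M = contradiction s≤M s≰M

  sequence-late : ∀ (PX PY : Schedule k) s → sequence M PX PY (s + suc M) ≡ PY s
  sequence-late {M = M} PX PY s with s + suc M ≤? M
  ... | yes s+1+M≤M = contradiction s+1+M≤M (<⇒≱ (≤-trans (n<1+n M) (m≤n+m (suc M) s)))
  ... | no  _       = cong PY (m+n∸n≡m s (suc M))

  module Sequencing
    {k M₁ : ℕ} {S X Y : VertexSet n}
    (cover : ∀ {v} → v ∈ S → v ∈ X ⊎ v ∈ Y) (separated : Separated X Y)
    (PX : Schedule k) (PX-within : ProbesWithin X PX)
    (sweepX : ∀ r → Confined X M₁ r → Σ[ t ∈ ℕ ] t ≤ M₁ × Detected PX t r × Located X PX t r)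
    (PY : Schedule k)
    where

    P : Schedule k
    P = sequence M₁ PX PY

    shift : (ℕ → Fin n) → ℕ → Fin n
    shift r s = r (s + suc M₁)

    X-closed : ∀ {u v} → u ∈ X → v ∈ S → Edge G u v → v ∈ X
    X-closed u∈X v∈S uv with cover v∈S
    ... | inj₁ v∈X = v∈X
    ... | inj₂ v∈Y = contradiction (separated u∈X v∈Y) (probe-adj≢r* uv)

    Y-closed : ∀ {u v} → u ∈ Y → v ∈ S → Edge G u v → v ∈ Y
    Y-closed u∈Y v∈S uv with cover v∈S
    ... | inj₂ v∈Y = v∈Y
    ... | inj₁ v∈X = contradiction (separated v∈X u∈Y) (probe-adj≢r* (Edge-sym G uv))

    M₁≤ : ∀ t → M₁ ≤ t + suc M₁
    M₁≤ t = ≤-trans (n≤1+n M₁) (m≤n+m (suc M₁) t)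

    in-X : ∀ {M} → Confined S M r → r 0 ∈ X → M₁ ≤ M → Confined X M₁ r
    in-X confined r0∈X M₁≤M = stays-in X-closed (Confined-≤ M₁≤M confined) r0∈X

    in-Y : ∀ {t} → Confined S (t + suc M₁) r → r 0 ∈ Y → Confined Y t (shift r)
    in-Y {t = t} confined r0∈Y =
      let (r∈Y , moves) = stays-in Y-closed confined r0∈Y
      in (λ s≤t → r∈Y (+-monoˡ-≤ (suc M₁) s≤t)) , (λ s<t → moves (+-monoˡ-< (suc M₁) s<t))

    early : ∀ {t} → t ≤ M₁ → Indistinguishable P t r r′ → Indistinguishable PX t r r′
    early {r = r} {r′} t≤M₁ same {s} s≤t i =
      subst (λ Q → answer (Q i) (r s) ≡ answer (Q i) (r′ s)) (sequence-early PX PY (≤-trans s≤t t≤M₁)) (same s≤t i)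

    late : ∀ {t} → Indistinguishable P (t + suc M₁) r r′ → Indistinguishable PY t (shift r) (shift r′)
    late {r = r} {r′} same {s} s≤t i =
      subst (λ Q → answer (Q i) (shift r s) ≡ answer (Q i) (shift r′ s)) (sequence-late PX PY s)
            (same (+-monoˡ-≤ (suc M₁) s≤t) i)

    detected-early : ∀ {t} → t ≤ M₁ → Detected PX t r → Detected P t r
    detected-early {r = r} t≤M₁ (s , s≤t , i , heard) =
      s , s≤t , i , subst (λ Q → answer (Q i) (r s) ≢ r*) (sym (sequence-early PX PY (≤-trans s≤t t≤M₁))) heard

    detected-late : ∀ {t} → Detected PY t (shift r) → Detected P (t + suc M₁) r
    detected-late {r = r} (s , s≤t , i , heard) =
      s + suc M₁ , +-monoˡ-≤ (suc M₁) s≤t , i ,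
      subst (λ Q → answer (Q i) (shift r s) ≢ r*) (sym (sequence-late PX PY s)) heard

    silent : ∀ {s} → r s ∈ Y → ∀ i → answer (PX s i) (r s) ≡ r*
    silent {s = s} rs∈Y i with PX s i in eq
    ... | nothing = refl
    ... | just u  = separated (PX-within s i eq) rs∈Y

    heard⇒distinguishable : ∀ {t} → t ≤ M₁ → Detected PX t r′ → Confined Y t r →
                              ¬ Indistinguishable P t r r′
    heard⇒distinguishable {r′ = r′} {r = r} t≤M₁ (s , s≤t , i , heard) (r∈Y , _) same =
      heard (trans (sym (early {r = r} {r′} t≤M₁ same s≤t i)) (silent {r = r} (r∈Y s≤t) i))

    located-in-X : ∀ {t} → t ≤ M₁ → Detected PX t r → Located X PX t r → Located S P t r
    located-in-X t≤M₁ detected located r′ confined′ same with cover (proj₁ confined′ z≤n)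
    ... | inj₁ r′0∈X = located r′ (stays-in X-closed confined′ r′0∈X) (early t≤M₁ same)
    ... | inj₂ r′0∈Y = ⊥-elim (heard⇒distinguishable t≤M₁ detected (stays-in Y-closed confined′ r′0∈Y)
                                 (Indistinguishable-sym {P = P} same))

    located-in-Y : ∀ {t} → Confined S M₁ r → r 0 ∈ Y → Located Y PY t (shift r) →
                   Located S P (t + suc M₁) r
    located-in-Y {t = t} confined r0∈Y located r′ confined′ same with cover (proj₁ confined′ z≤n)
    ... | inj₂ r′0∈Y = located (shift r′) (in-Y confined′ r′0∈Y) (late same)
    ... | inj₁ r′0∈X with sweepX r′ (in-X confined′ r′0∈X (M₁≤ t))
    ...   | t′ , t′≤M₁ , detected , _ =
            ⊥-elim (heard⇒distinguishable t′≤M₁ detected (stays-in Y-closed (Confined-≤ t′≤M₁ confined) r0∈Y)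
                      (Indistinguishable-≤ {P = P} (≤-trans t′≤M₁ (M₁≤ t)) same))

  sequence-sweeps : ∀ {M₁ M₂} → (∀ {v} → v ∈ S → v ∈ X ⊎ v ∈ Y) → X ⊆ S → Y ⊆ S → Separated X Y →
                    Sweeps X k M₁ → Sweeps Y k M₂ → Sweeps S k (M₂ + suc M₁)
  sequence-sweeps {S = S} {k = k} {M₁} {M₂} cover X⊆S Y⊆S separated
                  (PX , PX-within , sweepX) (PY , PY-within , sweepY) = P , within , sweep
    where
    open Sequencing cover separated PX PX-within sweepX PY
    within : ProbesWithin S P
    within s i with s ≤? M₁
    ... | yes _ = X⊆S ∘ PX-within s i
    ... | no  _ = Y⊆S ∘ PY-within (s ∸ suc M₁) i
    sweep : ∀ r → Confined S (M₂ + suc M₁) r →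
            Σ[ t ∈ ℕ ] t ≤ M₂ + suc M₁ × Detected P t r × Located S P t r
    sweep r confined with cover (proj₁ confined z≤n)
    ... | inj₁ r0∈X =
      let (t , t≤M₁ , detected , located) = sweepX r (in-X confined r0∈X (M₁≤ M₂))
      in t , ≤-trans t≤M₁ (M₁≤ M₂) , detected-early t≤M₁ detected , located-in-X t≤M₁ detected located
    ... | inj₂ r0∈Y =
      let (t , t≤M₂ , detected , located) = sweepY (shift r) (in-Y confined r0∈Y)
      in t + suc M₁ , +-monoˡ-≤ (suc M₁) t≤M₂ , detected-late detected ,
         located-in-Y (Confined-≤ (M₁≤ M₂) confined) r0∈Y located

  sequence-locates : ∀ {M₁ M₂} → (∀ {v} → v ∈ S → v ∈ X ⊎ v ∈ Y) → Separated X Y →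
                     Sweeps X k M₁ → Locates Y k M₂ → Locates S k (M₂ + suc M₁)
  sequence-locates {S = S} {k = k} {M₁} {M₂} cover separated (PX , PX-within , sweepX) (PY , locateY) = P , locate
    where
    open Sequencing cover separated PX PX-within sweepX PY
    locate : ∀ r → Confined S (M₂ + suc M₁) r → Σ[ t ∈ ℕ ] t ≤ M₂ + suc M₁ × Located S P t r
    locate r confined with cover (proj₁ confined z≤n)
    ... | inj₁ r0∈X =
      let (t , t≤M₁ , detected , located) = sweepX r (in-X confined r0∈X (M₁≤ M₂))
      in t , ≤-trans t≤M₁ (M₁≤ M₂) , located-in-X t≤M₁ detected located
    ... | inj₂ r0∈Y =
      let (t , t≤M₂ , located) = locateY (shift r) (in-Y confined r0∈Y)
      in t + suc M₁ , +-monoˡ-≤ (suc M₁) t≤M₂ , located-in-Y (Confined-≤ (M₁≤ M₂) confined) r0∈Y located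

  -- Idle cops are made to probe an arbitrary vertex d: extra answers only
  -- refine the information available to the cops.
  toStrategy : Fin n → Schedule k → Strategy G k
  toStrategy d P h = tabulate λ i → fromMaybe d (P (length h) i)

  private
    round-answers : Strategy G k → (ℕ → Fin n) → ℕ → Vec Resp k
    round-answers σ r s = Vec.map (λ u → probe G u (r s)) (σ (history G σ r s))

    history-length : ∀ (σ : Strategy G k) r t → length (history G σ r t) ≡ t
    history-length σ r zero    = refl
    history-length σ r (suc t) = cong suc (history-length σ r t)

    same-round : ∀ (σ : Strategy G k) r r′ t → history G σ r′ (suc t) ≡ history G σ r (suc t) →
                 ∀ {s} → s ≤ t → round-answers σ r′ s ≡ round-answers σ r s
    same-round σ r r′ zero    eq z≤n = ∷-injectiveˡ eq
    same-round σ r r′ (suc t) eq s≤1+t with m≤n⇒m<n∨m≡n s≤1+t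
    ... | inj₂ refl         = ∷-injectiveˡ eq
    ... | inj₁ (s≤s s≤t) = same-round σ r r′ t (∷-injectiveʳ eq) s≤t

    lookup-round : ∀ d (P : Schedule k) r s i →
                   lookup (round-answers (toStrategy d P) r s) i ≡ probe G (fromMaybe d (P s i)) (r s)
    lookup-round {k = k} d P r s i = begin
      lookup (round-answers σ r s) i               ≡⟨ lookup-map i _ (σ (history G σ r s)) ⟩
      probe G (lookup (σ (history G σ r s)) i) (r s) ≡⟨ cong (λ u → probe G u (r s)) (lookup∘tabulate _ i) ⟩
      probe G (fromMaybe d (P (length (history G σ r s)) i)) (r s)
        ≡⟨ cong (λ m → probe G (fromMaybe d (P m i)) (r s)) (history-length σ r s) ⟩
      probe G (fromMaybe d (P s i)) (r s)           ∎
      where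
      open ≡-Reasoning
      σ : Strategy G k
      σ = toStrategy d P

    answer-from-probe : ∀ d m {v v′} → probe G (fromMaybe d m) v′ ≡ probe G (fromMaybe d m) v →
                        answer m v ≡ answer m v′
    answer-from-probe d nothing  _  = refl
    answer-from-probe d (just u) eq = sym eq

  Locates⇒CopsWin : Fin n → Locates (λ _ → true) k M → CopsWin G k
  Locates⇒CopsWin {k = k} d (P , locate) = σ , winning
    where
    σ : Strategy G k
    σ = toStrategy d P
    winning : Winning G σ
    winning (r , moves) =
      let (t , _ , located) = locate r ((λ _ → holds refl) , λ {s} _ → moves s)
      in t , λ (r′ , moves′) same-history →
        located r′ ((λ _ → holds refl) , λ {s} _ → moves′ s) λ {s} s≤t i →
          answer-from-probe d (P s i)
            (begin
              probe G (fromMaybe d (P s i)) (r′ s)  ≡⟨ lookup-round d P r′ s i ⟨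
              lookup (round-answers σ r′ s) i       ≡⟨ cong (λ a → lookup a i) (same-round σ r r′ t same-history s≤t) ⟩
              lookup (round-answers σ r s) i        ≡⟨ lookup-round d P r s i ⟩
              probe G (fromMaybe d (P s i)) (r s)   ∎)
      where open ≡-Reasoning

half-< : ∀ {a b} k → 2 * a ≤ b → b < 2 ^ suc k → a < 2 ^ k
half-< {a} k 2a≤b b<2^1+k = *-cancelˡ-< 2 a (2 ^ k) (≤-<-trans 2a≤b b<2^1+k)

half-≤ : ∀ {a b} k → 2 * a ≤ b → b ≤ 2 ^ suc k → a ≤ 2 ^ k
half-≤ k 2a≤b b≤2^1+k = *-cancelˡ-≤ 2 (≤-trans 2a≤b b≤2^1+k)

module Strategies {n : ℕ} {G : Graph n} (ρ : Rooting G) where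

  open Rooting ρ
  open Components ρ
  open Localization G

  component-separated : ∀ {S : VertexSet n} v → Separated (component S v) (remainder S v)
  component-separated v u∈ w∈ = let (u≢w , ¬uw) = component-remainder-apart u∈ w∈ in probe-r* u≢w ¬uw

  remainder-separated : ∀ {S : VertexSet n} v → Separated (remainder S v) (component S v)
  remainder-separated v w∈ u∈ =
    let (u≢w , ¬uw) = component-remainder-apart u∈ w∈ in probe-r* (u≢w ∘ sym) (¬uw ∘ Edge-sym G)

  small-within : ∀ {S Z : VertexSet n} {b} → Z ⊆ S → ParentClosed Z S →
                 (∀ {v} → v ∈ Z → ∣ component S v ∣ < b) → ∀ {v} → v ∈ Z → ∣ component Z v ∣ < b
  small-within Z⊆S closed small v∈Z = ≤-<-trans (∣∣-mono (component-mono Z⊆S closed v∈Z)) (small v∈Z)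

  small⇒sweeps : ∀ S k → Acc _<_ ∣ S ∣ → (∀ {v} → v ∈ S → ∣ component S v ∣ < 2 ^ k) →
                 Σ[ M ∈ ℕ ] Sweeps S k M
  small⇒sweeps S k (acc smaller) small with any? (_∈? S)
  ... | no  S=∅ = 0 , sweep-∅ λ v v∈S → S=∅ (v , v∈S)
  ... | yes (v₀ , v₀∈S) with any? (_∈? remainder S v₀)
  ...   | yes (y , y∈Y) = _ , sequence-sweeps (component-or-remainder v₀) X⊆S Y⊆S (component-separated v₀)
                                (proj₂ (small⇒sweeps X k (smaller X⊂S) (small-within X⊆S (component-closed v₀) (small ∘ X⊆S))))
                                (proj₂ (small⇒sweeps Y k (smaller Y⊂S) (small-within Y⊆S (remainder-closed v₀) (small ∘ Y⊆S))))
    where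
    X Y : VertexSet n
    X = component S v₀
    Y = remainder S v₀
    X⊆S : X ⊆ S
    X⊆S = proj₁ ∘ ∈-component⁻
    Y⊆S : Y ⊆ S
    Y⊆S = proj₁ ∘ ∈-remainder⁻
    X⊂S : ∣ X ∣ < ∣ S ∣
    X⊂S = ∣∣-mono-< X⊆S (Y⊆S y∈Y) λ y∈X → proj₂ (∈-remainder⁻ y∈Y) (proj₂ (∈-component⁻ y∈X))
    Y⊂S : ∣ Y ∣ < ∣ S ∣
    Y⊂S = ∣∣-mono-< Y⊆S v₀∈S λ v₀∈Y → proj₂ (∈-remainder⁻ v₀∈Y) refl
  ...   | no  Y=∅ = sweep-connected k (≤-<-trans (∣∣-mono S⊆X) (small v₀∈S))
    where
    S⊆X : S ⊆ component S v₀
    S⊆X {w} w∈S with component-or-remainder v₀ w∈S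
    ... | inj₁ w∈X = w∈X
    ... | inj₂ w∈Y = contradiction (w , w∈Y) Y=∅
    connected : Connected-in S
    connected u∈S w∈S = trans (proj₂ (∈-component⁻ (S⊆X u∈S))) (sym (proj₂ (∈-component⁻ (S⊆X w∈S))))
    sweep-connected : ∀ k → ∣ S ∣ < 2 ^ k → Σ[ M ∈ ℕ ] Sweeps S k M
    sweep-connected zero ∣S∣<1 = contradiction (<-≤-trans (∣∣-pos v₀∈S) (≤-pred ∣S∣<1)) (<-irrefl refl)
    sweep-connected (suc k) ∣S∣<2^1+k =
      let (c , c∈S , balanced) = centroid v₀∈S connected
      in _ , guard-sweeps c∈S
               (proj₂ (small⇒sweeps (S ∖ ⁅ c ⁆) k (smaller (∣∖⁅⁆∣< c∈S)) λ v∈ → half-< k (balanced v∈) ∣S∣<2^1+k))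

  -- After removing a centroid at most one component can have 2 ^ k vertices
  -- (two would already outnumber S); it is located last, the rest swept first.
  connected⇒locates : ∀ S k → Acc _<_ ∣ S ∣ → Connected-in S → ∣ S ∣ ≤ 2 ^ k → Σ[ M ∈ ℕ ] Locates S k M
  connected⇒locates S k _ _ _ with any? (_∈? S)
  connected⇒locates S k _ _ _ | no S=∅ = 0 , Sweeps⇒Locates (sweep-∅ λ v v∈S → S=∅ (v , v∈S))
  connected⇒locates S zero _ _ ∣S∣≤1 | yes _ = 0 , locate-≤1 (∣∣≤1⇒≡ ∣S∣≤1)
  connected⇒locates S (suc k) (acc smaller) connected ∣S∣≤2^1+k | yes (v₀ , v₀∈S) =
    let (c , c∈S , balanced) = centroid v₀∈S connected in _ , guard-locates (proj₂ (locate-without c c∈S balanced))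
    where
    locate-without : ∀ c → c ∈ S → (∀ {v} → v ∈ S ∖ ⁅ c ⁆ → 2 * ∣ component (S ∖ ⁅ c ⁆) v ∣ ≤ ∣ S ∣) →
                     Σ[ M ∈ ℕ ] Locates (S ∖ ⁅ c ⁆) k M
    locate-without c c∈S balanced = by-big-component (any? λ v → (v ∈? S′) ×-dec (2 ^ k ≤? ∣ component S′ v ∣))
      where
      S′ : VertexSet n
      S′ = S ∖ ⁅ c ⁆
      S′⊂S : ∣ S′ ∣ < ∣ S ∣
      S′⊂S = ∣∖⁅⁆∣< c∈S
      by-big-component : Dec (Σ[ v ∈ Fin n ] v ∈ S′ × 2 ^ k ≤ ∣ component S′ v ∣) → Σ[ M ∈ ℕ ] Locates S′ k M
      by-big-component (no no-big) =
        _ , Sweeps⇒Locates (proj₂ (small⇒sweeps S′ k (smaller S′⊂S) λ v∈ → ≰⇒> λ big → no-big (_ , v∈ , big)))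
      by-big-component (yes (v₁ , v₁∈S′ , big)) =
        _ , sequence-locates (swap ∘ component-or-remainder v₁) (remainder-separated v₁) (proj₂ sweep-Y) (proj₂ locate-X)
        where
        X Y : VertexSet n
        X = component S′ v₁
        Y = remainder S′ v₁
        locate-X : Σ[ M ∈ ℕ ] Locates X k M
        locate-X = connected⇒locates X k (smaller (≤-<-trans (∣∣-mono (proj₁ ∘ ∈-component⁻)) S′⊂S))
                     (component-connected v₁) (half-≤ k (balanced v₁∈S′) ∣S∣≤2^1+k)
        Y-components : ∀ {v} → v ∈ Y → ∣ component S′ v ∣ < 2 ^ k
        Y-components {v} v∈Y = +-cancelˡ-< (2 ^ k) _ _ (begin-strict
          2 ^ k + ∣ component S′ v ∣ ≤⟨ +-monoˡ-≤ _ big ⟩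
          ∣ X ∣ + ∣ component S′ v ∣ ≤⟨ ∣∣-disjoint (proj₁ ∘ ∈-component⁻) (proj₁ ∘ ∈-component⁻) disjoint ⟩
          ∣ S′ ∣                     <⟨ S′⊂S ⟩
          ∣ S ∣                      ≤⟨ ∣S∣≤2^1+k ⟩
          2 ^ k + (2 ^ k + 0)        ≡⟨ cong (2 ^ k +_) (+-identityʳ (2 ^ k)) ⟩
          2 ^ k + 2 ^ k              ∎)
          where
          open ≤-Reasoning
          disjoint : ∀ {w} → w ∈ X → w ∉ component S′ v
          disjoint w∈X w∈ = proj₂ (∈-remainder⁻ v∈Y)
            (trans (sym (proj₂ (∈-component⁻ w∈))) (proj₂ (∈-component⁻ w∈X)))
        sweep-Y : Σ[ M ∈ ℕ ] Sweeps Y k M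
        sweep-Y = small⇒sweeps Y k (smaller (≤-<-trans (∣∣-mono Y⊆S′) S′⊂S))
                    (small-within Y⊆S′ (remainder-closed v₁) Y-components)
          where
          Y⊆S′ : Y ⊆ S′
          Y⊆S′ = proj₁ ∘ ∈-remainder⁻

n≤2^⌈log₂n⌉ : ∀ n → n ≤ 2 ^ ⌈log₂ n ⌉
n≤2^⌈log₂n⌉ n = bound n (<-wellFounded n)
  where
  bound : ∀ n (a : Acc _<_ n) → n ≤ 2 ^ ⌈log2⌉ n a
  bound zero          _        = z≤n
  bound (suc zero)    _        = s≤s z≤n
  bound (suc (suc m)) (acc rs) = begin
    2 + m                   ≤⟨ +-monoʳ-≤ 2 m≤2⌈m/2⌉ ⟩
    2 + (⌈ m /2⌉ + ⌈ m /2⌉) ≡⟨ cong suc (+-suc ⌈ m /2⌉ ⌈ m /2⌉) ⟨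
    suc ⌈ m /2⌉ + suc ⌈ m /2⌉ ≡⟨ cong (suc ⌈ m /2⌉ +_) (+-identityʳ (suc ⌈ m /2⌉)) ⟨
    2 * suc ⌈ m /2⌉         ≤⟨ *-monoʳ-≤ 2 (bound (suc ⌈ m /2⌉) (rs (⌈n/2⌉<n m))) ⟩
    2 * 2 ^ ⌈log2⌉ (suc ⌈ m /2⌉) (rs (⌈n/2⌉<n m)) ∎
    where
    open ≤-Reasoning
    m≤2⌈m/2⌉ : m ≤ ⌈ m /2⌉ + ⌈ m /2⌉
    m≤2⌈m/2⌉ = subst (_≤ ⌈ m /2⌉ + ⌈ m /2⌉) (⌊n/2⌋+⌈n/2⌉≡n m) (+-monoˡ-≤ ⌈ m /2⌉ (⌊n/2⌋≤⌈n/2⌉ m))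

mainTheorem10 : (n : ℕ) → 2 ≤ n → (T : Graph n) → IsTree T → ζ₁≤ T ⌈log₂ n ⌉
mainTheorem10 n@(suc (suc _)) _ T (connected , acyclic) =
  ⌈log₂ n ⌉ , s≤s z≤n , ≤-refl ,
  Localization.Locates⇒CopsWin T zero
    (proj₂ (connected⇒locates (λ _ → true) ⌈log₂ n ⌉ (<-wellFounded _) full-connected
                   (subst (_≤ 2 ^ ⌈log₂ n ⌉) (sym ∣all∣) (n≤2^⌈log₂n⌉ n))))
  where
  ρ : Rooting T
  ρ = BreadthFirst.rooting T connected zero acyclic
  open Components ρ using (full-connected)
  open Strategies ρ using (connected⇒locates)
mainTheorem10 (suc zero) (s≤s ()) _ _
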